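{- Let $p,h,k$ be positive integers, $\alpha\in I_{(h,k)}$ and $\pi\in\mathcal S_{(p,h,k),\alpha}$. Then the Bar Code $\mathcal B_\pi$ determined by $\pi$ is admissible; equivalently, the set $\mathsf N_\pi=\{x_1^{a}x_2^{j-i}x_3^{i-1} : 1\le i\le k,\ i\le j\le i+\alpha_i-1,\ 0\le a\le\pi_{i,j}-1\}$ is an order ideal of terms of $\mathbf k[x_1,x_2,x_3]$.
   Context: $I_{(h,k)}$ is the set of $(\alpha_1,\dots,\alpha_k)\in\mathbb N^k$ with $\alpha_1>\dots>\alpha_k>0$ and $\sum\alpha_i=h$. For $\alpha\in I_{(h,k)}$, $\mathcal S_{(p,h,k),\alpha}$ is the set of shifted arrays $\pi=(\pi_{i,j})_{1\le i\le k,\ i\le j\le i+\alpha_i-1}$ of integers with $\pi_{i,j}>0$; $\pi_{i,j}>\pi_{i,j+1}$ for $i\le j<i+\alpha_i-1$; $\pi_{i,j}\ge\pi_{i+1,j}$ for $1\le i\le k-1$, $i+1\le j\le i+\alpha_{i+1}$ (wherever both entries are defined); and $\sum_{i,j}\pi_{i,j}=p$. The Bar Code $\mathcal B_\pi$ has $k$ bars in row 3; over the $i$-th 3-bar lie $\alpha_i$ 2-bars, and over the $(j-i+1)$-th of these lie $\pi_{i,j}$ 1-bars (single columns). For an abstract Bar Code (rows of interval partitions of the columns, row 1 singletons, each row refining the next), the e-list of a column $c$ is $(b_1,b_2,b_3)$, where $b_3$ is the number of 3-bars left of the one containing $c$ and $b_i$ ($i=1,2$) is the number of $i$-bars inside the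 $(i+1)$-bar containing $c$ and to the left of the $i$-bar containing $c$; the Bar Code is admissible if $\{x_1^{b_1}x_2^{b_2}x_3^{b_3}\}$ over all columns is an order ideal (closed under divisors). For $\mathcal B_\pi$ this set is $\mathsf N_\pi$. -}

module Defs where

open import Data.Nat using (ℕ; zero; suc; _+_; _∸_; _≤_; _<_)
open import Data.List using (List; map; applyUpTo)
open import Data.Nat.ListAction using (sum)
open import Data.Product using (Σ; ∃; _×_; _,_)
open import Relation.Binary.PropositionalEquality using (_≡_)

sumFrom : ℕ → ℕ → (ℕ → ℕ) → ℕ
sumFrom lo n f = sum (map f (applyUpTo (lo +_) n))

-- A sequence α is encoded as a function ℕ → ℕ, 1-indexed; only α 1 … α k matter.
-- α ∈ I_(h,k): α_1 > … > α_k > 0 and Σ α_i = h.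
InI : ℕ → ℕ → (ℕ → ℕ) → Set
InI h k α =
  (∀ i → 1 ≤ i → i ≤ k → 0 < α i) ×
  (∀ i → 1 ≤ i → suc i ≤ k → α (suc i) < α i) ×
  (sumFrom 1 k α ≡ h)

InShape : ℕ → (ℕ → ℕ) → ℕ → ℕ → Set
InShape k α i j = (1 ≤ i) × (i ≤ k) × (i ≤ j) × (j < i + α i)

-- A shifted array is encoded as π : ℕ → ℕ → ℕ, only entries in the shape matter.
-- π ∈ S_(p,h,k),α  (α is assumed in I_(h,k) separately).
InS : ℕ → ℕ → (ℕ → ℕ) → (ℕ → ℕ → ℕ) → Set
InS p k α π =
  (∀ i j → InShape k α i j → 0 < π i j) ×
  (∀ i j → InShape k α i j → InShape k α i (suc j) → π i (suc j) < π i j) ×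
  (∀ i j → 1 ≤ i → suc i ≤ k → suc i ≤ j → j ≤ i + α (suc i) →
     InShape k α i j → InShape k α (suc i) j → π (suc i) j ≤ π i j) ×
  (sumFrom 1 k (λ i → sumFrom i (α i) (π i)) ≡ p)

-- Terms x1^a x2^b x3^c of k[x1,x2,x3] are encoded by exponent triples.
Term : Set
Term = ℕ × ℕ × ℕ

_∣ᵗ_ : Term → Term → Set
(a , b , c) ∣ᵗ (a' , b' , c') = (a ≤ a') × (b ≤ b') × (c ≤ c')

IsOrderIdeal : (Term → Set) → Set
IsOrderIdeal N = ∀ s t → N t → s ∣ᵗ t → N s

-- N_π = { x1^a x2^(j-i) x3^(i-1) : 1≤i≤k, i≤j≤i+α_i-1, 0≤a≤π_{i,j}-1 },
-- i.e. the set of e-lists x1^b1 x2^b2 x3^b3 of the columns of the Bar Code B_π.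
Nπ : ℕ → (ℕ → ℕ) → (ℕ → ℕ → ℕ) → Term → Set
Nπ k α π (a , b , c) =
  Σ ℕ λ i → Σ ℕ λ j → InShape k α i j × (a < π i j) × (b ≡ j ∸ i) × (c ≡ i ∸ 1)

AdmissibleBπ : ℕ → (ℕ → ℕ) → (ℕ → ℕ → ℕ) → Set
AdmissibleBπ k α π = IsOrderIdeal (Nπ k α π)

{-# OPTIONS --safe #-}
-- Index the array by its row i and diagonal offset b = j − i, so that N_π consists of
-- the terms x1^a x2^b x3^(i−1) with b < α_i and a < π_{i,b+i}. It then suffices that both
-- conditions persist when b or i decreases. Along a row the entries decrease. One row
-- down the same diagonal, π_{i+1,b+i+1} ≤ π_{i,b+i+1} < π_{i,b+i}, and b + 1 < α_i
-- because α_{i+1} < α_i.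
module Submission where

open import Defs
open import Data.Nat using (ℕ; _<_; _≤_; suc; _+_; _∸_; s≤s; z≤n)
open import Data.Nat.Properties
open import Data.Product using (_×_; _,_)
open import Data.Sum using (inj₁; inj₂)
open import Relation.Binary.PropositionalEquality using (_≡_; refl; sym; subst)

module ShiftedArray
  (k : ℕ) (α : ℕ → ℕ) (π : ℕ → ℕ → ℕ)
  (α-decreasing : ∀ i → 1 ≤ i → suc i ≤ k → α (suc i) < α i)
  (π-rowDecreasing : ∀ i j → InShape k α i j → InShape k α i (suc j) → π i (suc j) < π i j)
  (π-columnAntitone : ∀ i j → 1 ≤ i → suc i ≤ k → suc i ≤ j → j ≤ i + α (suc i) →
     InShape k α i j → InShape k α (suc i) j → π (suc i) j ≤ π i j)
  where

  inShape : ∀ {i b} → 1 ≤ i → i ≤ k → b < α i → InShape k α i (b + i)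
  inShape {i} {b} 1≤i i≤k b<α =
    1≤i , i≤k , m≤n+m i b , subst (b + i <_) (+-comm (α i) i) (+-monoˡ-< i b<α)

  row-antitone : ∀ {i b′ b} → 1 ≤ i → i ≤ k → b′ ≤ b → b < α i →
                 π i (b + i) ≤ π i (b′ + i)
  row-antitone 1≤i i≤k b′≤b b<α with m≤n⇒m<n∨m≡n b′≤b
  ... | inj₂ refl = ≤-refl
  ... | inj₁ (s≤s b′≤b-1) = ≤-trans
    (<⇒≤ (π-rowDecreasing _ _ (inShape 1≤i i≤k (<-trans (n<1+n _) b<α)) (inShape 1≤i i≤k b<α)))
    (row-antitone 1≤i i≤k b′≤b-1 (<-trans (n<1+n _) b<α))

  column-step : ∀ {i b} → 1 ≤ i → suc i ≤ k → b < α (suc i) →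
                b < α i × π (suc i) (b + suc i) ≤ π i (b + i)
  column-step {i} {b} 1≤i 1+i≤k b<α′ = <-trans (n<1+n b) 1+b<α , ≤-trans below (<⇒≤ along)
    where
    i≤k : i ≤ k
    i≤k = ≤-trans (n≤1+n i) 1+i≤k
    1+b<α : suc b < α i
    1+b<α = <-≤-trans (s≤s b<α′) (α-decreasing i 1≤i 1+i≤k)
    b+1+i≡1+b+i : b + suc i ≡ suc b + i
    b+1+i≡1+b+i = +-suc b i
    b+1+i≤i+α′ : b + suc i ≤ i + α (suc i)
    b+1+i≤i+α′ = subst (_≤ i + α (suc i)) (sym b+1+i≡1+b+i)
                   (subst (suc b + i ≤_) (+-comm (α (suc i)) i) (+-monoˡ-≤ i b<α′))
    below : π (suc i) (b + suc i) ≤ π i (b + suc i)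
    below = π-columnAntitone i (b + suc i) 1≤i 1+i≤k (m≤n+m (suc i) b) b+1+i≤i+α′
              (subst (InShape k α i) (sym b+1+i≡1+b+i) (inShape 1≤i i≤k 1+b<α))
              (inShape (s≤s z≤n) 1+i≤k b<α′)
    along : π i (b + suc i) < π i (b + i)
    along = subst (λ j → π i j < π i (b + i)) (sym b+1+i≡1+b+i)
              (π-rowDecreasing i (b + i) (inShape 1≤i i≤k (<-trans (n<1+n b) 1+b<α))
                                         (inShape 1≤i i≤k 1+b<α))

  column-antitone : ∀ {i′ i b} → 1 ≤ i′ → i′ ≤ i → i ≤ k → b < α i →
                    b < α i′ × π i (b + i) ≤ π i′ (b + i′)
  column-antitone 1≤i′ i′≤i i≤k b<α with m≤n⇒m<n∨m≡n i′≤i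
  ... | inj₂ refl = b<α , ≤-refl
  ... | inj₁ (s≤s i′≤i-1) with column-step (≤-trans 1≤i′ i′≤i-1) i≤k b<α
  ...   | b<α₋ , step with column-antitone 1≤i′ i′≤i-1 (≤-trans (n≤1+n _) i≤k) b<α₋
  ...     | b<α′ , steps = b<α′ , ≤-trans step steps

  Nπ⇒entry : ∀ {a b c} → Nπ k α π (a , b , c) →
             suc c ≤ k × b < α (suc c) × a < π (suc c) (b + suc c)
  Nπ⇒entry (i , j , (s≤s z≤n , i≤k , i≤j , j<i+α) , a<π , refl , refl) =
    i≤k ,
    subst (j ∸ i <_) (m+n∸m≡n i (α i)) (∸-monoˡ-< j<i+α i≤j) ,
    subst (λ j → _ < π i j) (sym (m∸n+n≡m i≤j)) a<π

  entry⇒Nπ : ∀ {a b c} → suc c ≤ k → b < α (suc c) → a < π (suc c) (b + suc c) →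
             Nπ k α π (a , b , c)
  entry⇒Nπ {b = b} {c} i≤k b<α a<π =
    suc c , b + suc c , inShape (s≤s z≤n) i≤k b<α , a<π , sym (m+n∸n≡m b (suc c)) , refl

  Nπ-isOrderIdeal : IsOrderIdeal (Nπ k α π)
  Nπ-isOrderIdeal (a′ , b′ , c′) (a , b , c) t∈N (a′≤a , b′≤b , c′≤c)
    with Nπ⇒entry t∈N
  ... | i≤k , b<α , a<π with column-antitone (s≤s z≤n) (s≤s c′≤c) i≤k (≤-<-trans b′≤b b<α)
  ... | b′<α′ , down =
    entry⇒Nπ (≤-trans (s≤s c′≤c) i≤k) b′<α′
      (≤-<-trans a′≤a (<-≤-trans a<π (≤-trans (row-antitone (s≤s z≤n) i≤k b′≤b b<α) down)))

mainTheorem14 : (p h k : ℕ) → 0 < p → 0 < h → 0 < k →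
    (α : ℕ → ℕ) → InI h k α →
    (π : ℕ → ℕ → ℕ) → InS p k α π →
    AdmissibleBπ k α π
mainTheorem14 _ _ k _ _ _ α (_ , α-decreasing , _) π (_ , π-rowDecreasing , π-columnAntitone , _) =
  ShiftedArray.Nπ-isOrderIdeal k α π α-decreasing π-rowDecreasing π-columnAntitone
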